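{- Let $S\subseteq X$ be a non-empty generalised nice set and $J\subseteq I$ with $|J|=3$, and suppose $S'_J=S\cup\{\{0,0\}\}\cup\{\{0,j\}:j\in J\}$ is a generalised nice set. Then $|S|=1$ and $S'_J$ is collinear to one of the sets $\{\{0,0\},\{0,3\},\{0,4\},\{0,7\},\{1,2\}\}$ or $\{\{0,0\},\{0,1\},\{0,2\},\{0,5\},\{1,2\}\}$.
   Context: Let $I=\{1,\dots,7\}$ and $I_0=I\cup\{0\}$. The Fano plane on $I$ has the seven lines $\{1,2,5\},\{5,6,7\},\{1,4,7\},\{1,3,6\},\{2,4,6\},\{2,3,7\},\{3,4,5\}$. For distinct $i,j\in I$, $i*j$ is the third point of the unique line containing $i$ and $j$. The operation is extended to $I_0$ by $0*i=i*0=i$ and $i*i=0$ for all $i\in I_0$. A collineation is a bijection $\sigma:I_0\to I_0$ with $\sigma(i*j)=\sigma(i)*\sigma(j)$ for all $i,j\in I_0$. Let $X_0$ be the set of unordered pairs $\{i,j\}$ with $i,j\in I_0$, where $i=j$ is allowed, and $X=\{\{i,j\}:i,j\in I,\ i\neq j\}$. A collineation $\sigma$ acts on $X_0$ by $\tilde\sigma(\{i,j\})=\{\sigma(i),\sigma(j)\}$, hence on subsets; subsets $T,T'\subseteq X_0$ are collinear if $\tilde\sigma(T)=T'$ for some collineation $\sigma$. For $i,j,k\in I_0$ let $P_{\{i,j,k\}}=\{\{i,j\},\{j,k\},\{k,i\},\{i,j*k\},\{j,k*i\},\{k,i*j\}\}\subseteq X_0$. A subset $T\subseteq X_0$ is a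 generalised nice set if for all $i,j,k\in I_0$, $\{i,j\}\in T$ and $\{i*j,k\}\in T$ imply $P_{\{i,j,k\}}\subseteq T$. -}

module Defs where

open import Data.Bool using (Bool; true; false; _∧_; _∨_; if_then_else_)
open import Data.Nat using (ℕ; _≤ᵇ_)
open import Data.Fin using (Fin; toℕ; _≟_)
open import Data.Fin.Patterns
open import Data.Vec using (Vec; _∷_; []; lookup)
open import Data.Bool.ListAction using (any)
open import Data.List using (List; _∷_; []; allFin; concatMap; map; filter; length)
open import Data.Product using (_×_; _,_; Σ; ∃)
open import Function.Definitions using (Bijective)
open import Relation.Binary.PropositionalEquality using (_≡_; _≢_)
open import Relation.Nullary.Decidable using (⌊_⌋)

-- Points of I₀ = {0,…,7} are Fin 8; I = the non-zero ones.
Pt : Set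
Pt = Fin 8

-- multiplication table of i * j on I₀ (Fano plane with the seven given lines,
-- extended by 0 * i = i * 0 = i and i * i = 0)
table : Vec (Vec Pt 8) 8
table =
  (0F ∷ 1F ∷ 2F ∷ 3F ∷ 4F ∷ 5F ∷ 6F ∷ 7F ∷ []) ∷
  (1F ∷ 0F ∷ 5F ∷ 6F ∷ 7F ∷ 2F ∷ 3F ∷ 4F ∷ []) ∷
  (2F ∷ 5F ∷ 0F ∷ 7F ∷ 6F ∷ 1F ∷ 4F ∷ 3F ∷ []) ∷
  (3F ∷ 6F ∷ 7F ∷ 0F ∷ 5F ∷ 4F ∷ 1F ∷ 2F ∷ []) ∷
  (4F ∷ 7F ∷ 6F ∷ 5F ∷ 0F ∷ 3F ∷ 2F ∷ 1F ∷ []) ∷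
  (5F ∷ 2F ∷ 1F ∷ 4F ∷ 3F ∷ 0F ∷ 7F ∷ 6F ∷ []) ∷
  (6F ∷ 3F ∷ 4F ∷ 1F ∷ 2F ∷ 7F ∷ 0F ∷ 5F ∷ []) ∷
  (7F ∷ 4F ∷ 3F ∷ 2F ∷ 1F ∷ 6F ∷ 5F ∷ 0F ∷ []) ∷ []

infixl 7 _*_
_*_ : Pt → Pt → Pt
i * j = lookup (lookup table i) j

IsCollineation : (Pt → Pt) → Set
IsCollineation σ = Bijective _≡_ _≡_ σ × (∀ i j → σ (i * j) ≡ σ i * σ j)

-- A subset T of X₀ (unordered pairs {i,j}, i = j allowed) is represented by its
-- indicator on ordered pairs, required to be symmetric: {i,j} ∈ T iff T i j ≡ true.
PairSet : Set
PairSet = Pt → Pt → Bool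

Symmetric : PairSet → Set
Symmetric T = ∀ i j → T i j ≡ T j i

_∈ₚ_ : Pt × Pt → PairSet → Set
(i , j) ∈ₚ T = T i j ≡ true

SubsetOfX : PairSet → Set
SubsetOfX T = ∀ i j → (i , j) ∈ₚ T → (i ≢ 0F) × (j ≢ 0F) × (i ≢ j)

NonEmpty : PairSet → Set
NonEmpty T = ∃ λ i → ∃ λ j → (i , j) ∈ₚ T

-- number of unordered pairs {i,j} (i ≤ j) in T
card : PairSet → ℕ
card T = length (filter (λ p → Data.Bool._≟_ (T (Data.Product.proj₁ p) (Data.Product.proj₂ p)) true)
  (concatMap (λ i → map (λ j → (i , j)) (filter (λ j → Data.Nat._≤?_ (toℕ i) (toℕ j)) (allFin 8))) (allFin 8)))

PSub : Pt → Pt → Pt → PairSet → Set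
PSub i j k T =
  ((i , j) ∈ₚ T) × ((j , k) ∈ₚ T) × ((k , i) ∈ₚ T) ×
  ((i , j * k) ∈ₚ T) × ((j , k * i) ∈ₚ T) × ((k , i * j) ∈ₚ T)

GeneralisedNice : PairSet → Set
GeneralisedNice T = ∀ i j k → (i , j) ∈ₚ T → (i * j , k) ∈ₚ T → PSub i j k T

Collinear : PairSet → PairSet → Set
Collinear T T' = ∃ λ σ → IsCollineation σ × (∀ i j → T' (σ i) (σ j) ≡ T i j)

fromPairs : List (Pt × Pt) → PairSet
fromPairs ps i j = any (λ { (a , b) → (⌊ a ≟ i ⌋ ∧ ⌊ b ≟ j ⌋) ∨ (⌊ a ≟ j ⌋ ∧ ⌊ b ≟ i ⌋) }) ps

_∪ₚ_ : PairSet → PairSet → PairSet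
(T ∪ₚ U) i j = T i j ∨ U i j

S'J : PairSet → Pt → Pt → Pt → PairSet
S'J S j₁ j₂ j₃ = S ∪ₚ fromPairs ((0F , 0F) ∷ (0F , j₁) ∷ (0F , j₂) ∷ (0F , j₃) ∷ [])

setA : PairSet
setA = fromPairs ((0F , 0F) ∷ (0F , 3F) ∷ (0F , 4F) ∷ (0F , 7F) ∷ (1F , 2F) ∷ [])

setB : PairSet
setB = fromPairs ((0F , 0F) ∷ (0F , 1F) ∷ (0F , 2F) ∷ (0F , 5F) ∷ (1F , 2F) ∷ [])

-- (Pt, *, 0) is the group (ℤ/2)³ and the lines of the Fano plane are its subgroups of
-- order 4 with 0 removed.  Niceness of S'_J at the triples (0, a, b) and (a, b, 0) shows that
-- for every pair {a, b} ∈ S the line {a, b, a * b} lies inside J or avoids J.  At most one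
-- line does so: J itself if J is a line, otherwise {j₁ * j₂, j₁ * j₃, j₂ * j₃}, the only line
-- avoiding J.  Niceness of S at (a, b, a) and (a, b, b) leaves room for only one pair of S on
-- a line, so S = {{a, b}}.  Then S'_J = {{0,0}, {0,a}, {0,b}, {0,a*b}, {a,b}} in the first case,
-- and S'_J = {{0,0}, {0,j}, {0,j*a}, {0,j*b}, {a,b}} for the j ∈ J with j * a, j * b ∈ J in
-- the second; the collineation sending the frame (a, b, c) to (1, 2, 7), for c off the line
-- (c = j in the second case), maps these onto setB and setA.

module Submission where

open import Defs
open import Data.Bool using (true; _∨_; _∧_; if_then_else_)
import Data.Bool as Bool
open import Data.Bool.Properties using (T-≡; T-∨; ∨-comm; ∨-identityʳ; ∨-zeroʳ; ⇔→≡)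
open import Data.Empty using (⊥; ⊥-elim)
open import Data.Fin using (_≟_; toℕ)
open import Data.Fin.Patterns
open import Data.Fin.Properties using (all?; any?)
open import Data.List using (List; []; _∷_; _∷ʳ_; map; length; filter; concatMap; allFin)
open import Data.List.Properties using (map-++; filter-≐)
open import Data.List.Membership.Propositional using (_∈_; _∉_)
open import Data.List.Membership.Propositional.Properties using (∈-map⁺; ∈-map⁻)
open import Data.List.Membership.DecPropositional (_≟_ {n = 8}) using (_∈?_)
open import Data.List.Relation.Binary.Disjoint.Propositional using (Disjoint)
open import Data.List.Relation.Binary.Permutation.Propositional using (↭-sym)
open import Data.List.Relation.Binary.Permutation.Propositional.Properties using (shift; ∷↭∷ʳ)
open import Data.List.Relation.Binary.Subset.Propositional using (_⊆_)
open import Data.List.Relation.Binary.Subset.Propositional.Properties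
  using (⊆-reflexive-↭; ∈-∷⁺ʳ; ∷⁺ʳ; ++⁺ˡ; map⁺)
open import Data.List.Relation.Unary.Any using (here; there)
open import Data.Nat using (_≤?_)
import Data.Nat as ℕ
open import Data.Product using (_×_; _,_; proj₁; proj₂; ∃; Σ-syntax)
import Data.Product as Product
open import Data.Sum using (_⊎_; inj₁; inj₂)
import Data.Sum as Sum
open import Function using (_∘_; Equivalence; mk⇔)
open import Function.Definitions using (Injective; StrictlyInverseˡ; StrictlyInverseʳ)
open import Function.Consequences.Propositional
  using (inverseᵇ⇒bijective; strictlyInverseˡ⇒inverseˡ; strictlyInverseʳ⇒inverseʳ)
open import Relation.Binary.PropositionalEquality
  using (_≡_; _≢_; refl; sym; trans; cong; cong₂; subst; module ≡-Reasoning)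
open import Relation.Nullary using (Dec; yes; no; ¬?)
open import Relation.Nullary.Decidable using (from-yes; _×-dec_; _→-dec_; ⌊_⌋)

open ≡-Reasoning

-- The group (Pt, *, 0)

-- Facts decided by evaluation are opaque, so that later type checking never re-runs the check.
opaque
  *-assoc : ∀ a b c → (a * b) * c ≡ a * (b * c)
  *-assoc = from-yes (all? λ a → all? λ b → all? λ c → (a * b) * c ≟ a * (b * c))

  *-comm : ∀ a b → a * b ≡ b * a
  *-comm = from-yes (all? λ a → all? λ b → a * b ≟ b * a)

  *-identityˡ : ∀ a → 0F * a ≡ a
  *-identityˡ = from-yes (all? λ a → 0F * a ≟ a)

  a*a≡0 : ∀ a → a * a ≡ 0F
  a*a≡0 = from-yes (all? λ a → a * a ≟ 0F)

*-identityʳ : ∀ a → a * 0F ≡ a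
*-identityʳ a = trans (*-comm a 0F) (*-identityˡ a)

a*[a*b]≡b : ∀ a b → a * (a * b) ≡ b
a*[a*b]≡b a b = begin
  a * (a * b)  ≡⟨ *-assoc a a b ⟨
  (a * a) * b  ≡⟨ cong (_* b) (a*a≡0 a) ⟩
  0F * b       ≡⟨ *-identityˡ b ⟩
  b            ∎

b*[a*b]≡a : ∀ a b → b * (a * b) ≡ a
b*[a*b]≡a a b = trans (cong (b *_) (*-comm a b)) (a*[a*b]≡b b a)

*-cancelˡ-≡ : ∀ a {b c} → a * b ≡ a * c → b ≡ c
*-cancelˡ-≡ a {b} {c} ab≡ac = begin
  b            ≡⟨ a*[a*b]≡b a b ⟨
  a * (a * b)  ≡⟨ cong (a *_) ab≡ac ⟩
  a * (a * c)  ≡⟨ a*[a*b]≡b a c ⟩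
  c            ∎

*-cancelʳ-≡ : ∀ {a b} c → a * c ≡ b * c → a ≡ b
*-cancelʳ-≡ {a} {b} c ac≡bc = *-cancelˡ-≡ c (trans (*-comm c a) (trans ac≡bc (*-comm b c)))

a*b≡0⇒a≡b : ∀ {a b} → a * b ≡ 0F → a ≡ b
a*b≡0⇒a≡b {a} {b} ab≡0 = sym (*-cancelˡ-≡ a (trans ab≡0 (sym (a*a≡0 a))))

a*b≡a⇒b≡0 : ∀ {a b} → a * b ≡ a → b ≡ 0F
a*b≡a⇒b≡0 {a} ab≡a = *-cancelˡ-≡ a (trans ab≡a (sym (*-identityʳ a)))

a*b≡b⇒a≡0 : ∀ {a b} → a * b ≡ b → a ≡ 0F
a*b≡b⇒a≡0 {a} {b} ab≡b = a*b≡a⇒b≡0 (trans (*-comm b a) ab≡b)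

-- Lines of the Fano plane

InX : Pt → Pt → Set
InX i j = i ≢ 0F × j ≢ 0F × i ≢ j

InX? : ∀ i j → Dec (InX i j)
InX? i j = ¬? (i ≟ 0F) ×-dec ¬? (j ≟ 0F) ×-dec ¬? (i ≟ j)

Distinct₃ : {A : Set} → A → A → A → Set
Distinct₃ x y z = x ≢ y × x ≢ z × y ≢ z

line : Pt → Pt → List Pt
line a b = a ∷ b ∷ a * b ∷ []

line-distinct : ∀ {a b} → InX a b → Distinct₃ a b (a * b)
line-distinct (a≢0 , b≢0 , a≢b) = a≢b , b≢0 ∘ a*b≡a⇒b≡0 ∘ sym , a≢0 ∘ a*b≡b⇒a≡0 ∘ sym

opaque
  off-line-product∈line : ∀ {a b u v} → InX a b → InX u v → u ∉ line a b → v ∉ line a b → u * v ∈ line a b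
  off-line-product∈line {a} {b} {u} {v} = from-yes (all? λ a → all? λ b → all? λ u → all? λ v →
    InX? a b →-dec InX? u v →-dec ¬? (u ∈? line a b) →-dec ¬? (v ∈? line a b) →-dec u * v ∈? line a b) a b u v

lines-meet : ∀ {a b x y} → InX a b → InX x y → ∃ λ z → z ∈ line a b × z ∈ line x y
lines-meet {a} {b} {x} {y} ab xy with x ∈? line a b | y ∈? line a b
... | yes x∈ab | _        = x , x∈ab , here refl
... | no _     | yes y∈ab = y , y∈ab , there (here refl)
... | no x∉ab  | no y∉ab  = x * y , off-line-product∈line ab xy x∉ab y∉ab , there (there (here refl))

data Position (J : List Pt) (a b : Pt) : Set where
  inside  : line a b ⊆ J → Position J a b
  outside : Disjoint (line a b) J → Position J a b

module _ {A : Set} where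

  no-three-distinct-in-pair : ∀ {a b c x y : A} → Distinct₃ a b c →
    a ∈ x ∷ y ∷ [] → b ∈ x ∷ y ∷ [] → c ∈ x ∷ y ∷ [] → ⊥
  no-three-distinct-in-pair (a≢b , _ , _)   (here refl)         (here refl)         _                   = a≢b refl
  no-three-distinct-in-pair (_ , a≢c , _)   (here refl)         (there (here refl)) (here refl)         = a≢c refl
  no-three-distinct-in-pair (_ , _ , b≢c)   (here refl)         (there (here refl)) (there (here refl)) = b≢c refl
  no-three-distinct-in-pair (_ , _ , b≢c)   (there (here refl)) (here refl)         (here refl)         = b≢c refl
  no-three-distinct-in-pair (_ , a≢c , _)   (there (here refl)) (here refl)         (there (here refl)) = a≢c refl
  no-three-distinct-in-pair (a≢b , _ , _)   (there (here refl)) (there (here refl)) _                   = a≢b refl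

  distinct₃-⊆-covers-head : ∀ {a b c x y z : A} → Distinct₃ a b c →
    a ∷ b ∷ c ∷ [] ⊆ x ∷ y ∷ z ∷ [] → x ∈ a ∷ b ∷ c ∷ []
  distinct₃-⊆-covers-head abc abc⊆ with abc⊆ (here refl) | abc⊆ (there (here refl)) | abc⊆ (there (there (here refl)))
  ... | here a≡x  | _         | _         = here (sym a≡x)
  ... | _         | here b≡x  | _         = there (here (sym b≡x))
  ... | _         | _         | here c≡x  = there (there (here (sym c≡x)))
  ... | there a∈  | there b∈  | there c∈  = ⊥-elim (no-three-distinct-in-pair abc a∈ b∈ c∈)

  distinct₃-⊆⇒⊇ : ∀ {a b c x y z : A} → Distinct₃ a b c →
    a ∷ b ∷ c ∷ [] ⊆ x ∷ y ∷ z ∷ [] → x ∷ y ∷ z ∷ [] ⊆ a ∷ b ∷ c ∷ []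
  distinct₃-⊆⇒⊇ abc abc⊆ (here refl) = distinct₃-⊆-covers-head abc abc⊆
  distinct₃-⊆⇒⊇ {x = x} {y} {z} abc abc⊆ (there (here refl)) =
    distinct₃-⊆-covers-head abc (⊆-reflexive-↭ (shift y (x ∷ []) (z ∷ [])) ∘ abc⊆)
  distinct₃-⊆⇒⊇ {x = x} {y} {z} abc abc⊆ (there (there (here refl))) =
    distinct₃-⊆-covers-head abc (⊆-reflexive-↭ (shift z (x ∷ y ∷ []) []) ∘ abc⊆)

-- Sets of unordered pairs

infix 4 _≈ₚ_
_≈ₚ_ : PairSet → PairSet → Set
T ≈ₚ U = ∀ i j → T i j ≡ U i j

≈ₚ-trans : ∀ {T U V} → T ≈ₚ U → U ≈ₚ V → T ≈ₚ V
≈ₚ-trans T≈U U≈V i j = trans (T≈U i j) (U≈V i j)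

∨-true : ∀ {x y} → x ∨ y ≡ true → x ≡ true ⊎ y ≡ true
∨-true = Sum.map (Equivalence.to T-≡) (Equivalence.to T-≡) ∘ Equivalence.to T-∨ ∘ Equivalence.from T-≡

private
  ≟-both⁻ : ∀ {a b i j : Pt} → ⌊ a ≟ i ⌋ ∧ ⌊ b ≟ j ⌋ ≡ true → (i , j) ≡ (a , b)
  ≟-both⁻ {a} {b} {i} {j} h with a ≟ i | b ≟ j
  ≟-both⁻ refl | yes refl | yes refl = refl

  ≟-both⁺ : ∀ (a b : Pt) → ⌊ a ≟ a ⌋ ∧ ⌊ b ≟ b ⌋ ≡ true
  ≟-both⁺ a b with a ≟ a | b ≟ b
  ... | yes _   | yes _   = refl
  ... | no a≢a  | _       = ⊥-elim (a≢a refl)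
  ... | yes _   | no b≢b  = ⊥-elim (b≢b refl)

fromPairs-sym : ∀ ps i j → fromPairs ps i j ≡ fromPairs ps j i
fromPairs-sym []             i j = refl
fromPairs-sym ((a , b) ∷ ps) i j = cong₂ _∨_ (∨-comm (⌊ a ≟ i ⌋ ∧ ⌊ b ≟ j ⌋) _) (fromPairs-sym ps i j)

fromPairs⁺ : ∀ ps {i j} → (i , j) ∈ ps ⊎ (j , i) ∈ ps → (i , j) ∈ₚ fromPairs ps
fromPairs⁺ ps (inj₁ ij∈)         = ∈⇒∈ₚ ps ij∈
  where
  ∈⇒∈ₚ : ∀ qs {k l} → (k , l) ∈ qs → (k , l) ∈ₚ fromPairs qs
  ∈⇒∈ₚ ((a , b) ∷ qs) (here refl)  = cong (λ t → (t ∨ ⌊ a ≟ b ⌋ ∧ ⌊ b ≟ a ⌋) ∨ fromPairs qs a b) (≟-both⁺ a b)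
  ∈⇒∈ₚ (_ ∷ qs)       (there kl∈) = trans (cong (_ ∨_) (∈⇒∈ₚ qs kl∈)) (∨-zeroʳ _)
fromPairs⁺ ps {i} {j} (inj₂ ji∈) = trans (fromPairs-sym ps i j) (fromPairs⁺ ps (inj₁ ji∈))

fromPairs⁻ : ∀ ps {i j} → (i , j) ∈ₚ fromPairs ps → (i , j) ∈ ps ⊎ (j , i) ∈ ps
fromPairs⁻ ((a , b) ∷ ps) h with ∨-true h
... | inj₂ h′ = Sum.map there there (fromPairs⁻ ps h′)
... | inj₁ h′ with ∨-true h′
...   | inj₁ ij≡ab = inj₁ (here (≟-both⁻ ij≡ab))
...   | inj₂ ji≡ab = inj₂ (here (≟-both⁻ ji≡ab))

fromPairs-cong : ∀ {ps qs} → ps ⊆ qs → qs ⊆ ps → fromPairs ps ≈ₚ fromPairs qs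
fromPairs-cong {ps} {qs} ps⊆qs qs⊆ps i j = ⇔→≡ (mk⇔ (mono ps⊆qs) (mono qs⊆ps))
  where
  mono : ∀ {xs ys} → xs ⊆ ys → (i , j) ∈ₚ fromPairs xs → (i , j) ∈ₚ fromPairs ys
  mono {xs} {ys} xs⊆ys = fromPairs⁺ ys ∘ Sum.map xs⊆ys xs⊆ys ∘ fromPairs⁻ xs

fromPairs-image : ∀ {σ} → Injective _≡_ _≡_ σ → ∀ ps i j →
  fromPairs (map (Product.map σ σ) ps) (σ i) (σ j) ≡ fromPairs ps i j
fromPairs-image {σ} σ-inj []             i j = refl
fromPairs-image {σ} σ-inj ((a , b) ∷ ps) i j = cong₂ _∨_
  (cong₂ _∨_ (cong₂ _∧_ (≟-image a i) (≟-image b j)) (cong₂ _∧_ (≟-image a j) (≟-image b i)))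
  (fromPairs-image σ-inj ps i j)
  where
  ≟-image : ∀ x y → ⌊ σ x ≟ σ y ⌋ ≡ ⌊ x ≟ y ⌋
  ≟-image x y with σ x ≟ σ y | x ≟ y
  ... | yes _        | yes _    = refl
  ... | no _         | no _     = refl
  ... | yes σx≡σy    | no x≢y   = ⊥-elim (x≢y (σ-inj σx≡σy))
  ... | no σx≢σy     | yes x≡y  = ⊥-elim (σx≢σy (cong σ x≡y))

-- The list that card filters, copied from its definition so that card-cong can refer to it.
unorderedPairs : List (Pt × Pt)
unorderedPairs = concatMap (λ i → map (λ j → (i , j)) (filter (λ j → toℕ i ≤? toℕ j) (allFin 8))) (allFin 8)

card-cong : ∀ {S U} → S ≈ₚ U → card S ≡ card U
card-cong {S} {U} S≈U = cong length (filter-≐ S? U? (trans (sym (S≈U _ _)) , trans (S≈U _ _)) unorderedPairs)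
  where
  S? = λ p → S (proj₁ p) (proj₂ p) Bool.≟ true
  U? = λ p → U (proj₁ p) (proj₂ p) Bool.≟ true

opaque
  card-single-pair : ∀ {a b} → InX a b → card (fromPairs ((a , b) ∷ [])) ≡ 1
  card-single-pair {a} {b} =
    from-yes (all? λ a → all? λ b → InX? a b →-dec card (fromPairs ((a , b) ∷ [])) ℕ.≟ 1) a b

-- Collineations

IsHomomorphism : (Pt → Pt) → Set
IsHomomorphism σ = ∀ i j → σ (i * j) ≡ σ i * σ j

homomorphism-fixes-0 : ∀ {σ} → IsHomomorphism σ → σ 0F ≡ 0F
homomorphism-fixes-0 {σ} σ-hom = trans (σ-hom 0F 0F) (a*a≡0 (σ 0F))

collineation-from-inverse : ∀ {σ τ} → IsHomomorphism σ →
  StrictlyInverseˡ _≡_ σ τ → StrictlyInverseʳ _≡_ σ τ → IsCollineation σ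
collineation-from-inverse {σ} σ-hom στ τσ =
  inverseᵇ⇒bijective (strictlyInverseˡ⇒inverseˡ σ στ , strictlyInverseʳ⇒inverseʳ σ τσ) , σ-hom

Frame : Pt → Pt → Pt → Set
Frame u v w = InX u v × w ≢ 0F × w ∉ line u v

Frame? : ∀ u v w → Dec (Frame u v w)
Frame? u v w = InX? u v ×-dec ¬? (w ≟ 0F) ×-dec ¬? (w ∈? line u v)

opaque
  extend-to-frame : ∀ {a b} → InX a b → ∃ λ c → Frame a b c
  extend-to-frame {a} {b} =
    from-yes (all? λ a → all? λ b → InX? a b →-dec any? λ c → Frame? a b c) a b

-- Writes x as a product of u, v, w and returns the same product of u′, v′, w′.
frameMap : (u v w u′ v′ w′ : Pt) → Pt → Pt
frameMap u v w u′ v′ w′ x =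
  if ⌊ x ≟ u ⌋ then u′ else
  if ⌊ x ≟ v ⌋ then v′ else
  if ⌊ x ≟ w ⌋ then w′ else
  if ⌊ x ≟ u * v ⌋ then u′ * v′ else
  if ⌊ x ≟ u * w ⌋ then u′ * w′ else
  if ⌊ x ≟ v * w ⌋ then v′ * w′ else
  if ⌊ x ≟ u * v * w ⌋ then u′ * v′ * w′ else 0F

-- The target frame (1, 2, 7) is chosen so that collinear-setB and collinear-setA below land
-- exactly on setB and setA.
opaque
  frameMap-standardises : ∀ u v w → Frame u v w →
    let σ = frameMap u v w 1F 2F 7F
        τ = frameMap 1F 2F 7F u v w
    in IsHomomorphism σ × StrictlyInverseˡ _≡_ σ τ × StrictlyInverseʳ _≡_ σ τ ×
       σ u ≡ 1F × σ v ≡ 2F × σ w ≡ 7F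
  frameMap-standardises = from-yes (all? λ u → all? λ v → all? λ w → Frame? u v w →-dec
    let σ = frameMap u v w 1F 2F 7F
        τ = frameMap 1F 2F 7F u v w
    in (all? λ i → all? λ j → σ (i * j) ≟ σ i * σ j) ×-dec (all? λ y → σ (τ y) ≟ y) ×-dec
       (all? λ x → τ (σ x) ≟ x) ×-dec σ u ≟ 1F ×-dec σ v ≟ 2F ×-dec σ w ≟ 7F)

frame-collineation : ∀ {u v w} → Frame u v w →
  Σ[ σ ∈ (Pt → Pt) ] IsCollineation σ × σ u ≡ 1F × σ v ≡ 2F × σ w ≡ 7F
frame-collineation {u} {v} {w} uvw =
  let σ-hom , στ , τσ , images = frameMap-standardises u v w uvw
  in frameMap u v w 1F 2F 7F ,
     collineation-from-inverse {τ = frameMap 1F 2F 7F u v w} σ-hom στ τσ , images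

Collinear-respˡ : ∀ {T T′ U} → T ≈ₚ T′ → Collinear T′ U → Collinear T U
Collinear-respˡ T≈T′ (σ , σ-col , U≈σT′) = σ , σ-col , λ i j → trans (U≈σT′ i j) (sym (T≈T′ i j))

collinear-image : ∀ {σ} → IsCollineation σ → ∀ ps →
  Collinear (fromPairs ps) (fromPairs (map (Product.map σ σ) ps))
collinear-image {σ} σ-col@((σ-inj , _) , _) ps = σ , σ-col , fromPairs-image σ-inj ps

zeroPairs : List Pt → List (Pt × Pt)
zeroPairs J = (0F , 0F) ∷ map (0F ,_) J

zeroPairs⁻ : ∀ {J i j} → (i , j) ∈ zeroPairs J → i ≡ 0F × (j ≡ 0F ⊎ j ∈ J)
zeroPairs⁻ (here refl) = refl , inj₁ refl
zeroPairs⁻ (there ij∈) with ∈-map⁻ (0F ,_) ij∈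
... | _ , j∈J , refl = refl , inj₂ j∈J

zeroPairs-∈ₚ⁻ : ∀ J {z} → (0F , z) ∈ₚ fromPairs (zeroPairs J) → z ≢ 0F → z ∈ J
zeroPairs-∈ₚ⁻ J {z} 0z∈ z≢0 = Sum.[ Sum.fromInj₂ (⊥-elim ∘ z≢0) ∘ proj₂ ∘ zeroPairs⁻ , ⊥-elim ∘ z≢0 ∘ proj₁ ∘ zeroPairs⁻ ]
  (fromPairs⁻ (zeroPairs J) {0F} {z} 0z∈)

-- S'_J for S = {p}.  Listing p last makes setA and setB literally
-- S'J-pair (1F , 2F) (3F ∷ 4F ∷ 7F ∷ []) and S'J-pair (1F , 2F) (1F ∷ 2F ∷ 5F ∷ []).
S'J-pair : Pt × Pt → List Pt → PairSet
S'J-pair p J = fromPairs (zeroPairs J ∷ʳ p)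

S'J-single : ∀ {S} p j₁ j₂ j₃ → S ≈ₚ fromPairs (p ∷ []) →
  S'J S j₁ j₂ j₃ ≈ₚ S'J-pair p (j₁ ∷ j₂ ∷ j₃ ∷ [])
S'J-single p j₁ j₂ j₃ S≈p i j = trans (cong (_∨ _) (trans (S≈p i j) (∨-identityʳ _)))
  (fromPairs-cong (⊆-reflexive-↭ p∷J↭J∷ʳp) (⊆-reflexive-↭ (↭-sym p∷J↭J∷ʳp)) i j)
  where
  p∷J↭J∷ʳp = ∷↭∷ʳ p (zeroPairs (j₁ ∷ j₂ ∷ j₃ ∷ []))

S'J-pair-cong : ∀ p {J K} → J ⊆ K → K ⊆ J → S'J-pair p J ≈ₚ S'J-pair p K
S'J-pair-cong p J⊆K K⊆J = fromPairs-cong (widen J⊆K) (widen K⊆J)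
  where
  widen : ∀ {J K} → J ⊆ K → zeroPairs J ∷ʳ p ⊆ zeroPairs K ∷ʳ p
  widen J⊆K = ++⁺ˡ (p ∷ []) (∷⁺ʳ (0F , 0F) (map⁺ (0F ,_) J⊆K))

S'J-pair-image : ∀ {σ} → IsCollineation σ → ∀ a b J →
  Collinear (S'J-pair (a , b) J) (S'J-pair (σ a , σ b) (map σ J))
S'J-pair-image {σ} σ-col@(_ , σ-hom) a b J =
  subst (Collinear (S'J-pair (a , b) J) ∘ fromPairs) image (collinear-image σ-col (zeroPairs J ∷ʳ (a , b)))
  where
  σ² = Product.map σ σ
  image : map σ² (zeroPairs J ∷ʳ (a , b)) ≡ zeroPairs (map σ J) ∷ʳ (σ a , σ b)
  image = begin
    map σ² (zeroPairs J ∷ʳ (a , b))           ≡⟨ map-++ σ² (zeroPairs J) _ ⟩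
    map σ² (zeroPairs J) ∷ʳ (σ a , σ b)        ≡⟨ cong (_∷ʳ (σ a , σ b)) (zeroPairs-image J) ⟩
    zeroPairs (map σ J) ∷ʳ (σ a , σ b)        ∎
    where
    σ0≡0 = homomorphism-fixes-0 {σ} σ-hom
    zero-image : ∀ J → map σ² (map (0F ,_) J) ≡ map (0F ,_) (map σ J)
    zero-image []      = refl
    zero-image (j ∷ J) = cong₂ _∷_ (cong (_, σ j) σ0≡0) (zero-image J)
    zeroPairs-image : ∀ J → map σ² (zeroPairs J) ≡ zeroPairs (map σ J)
    zeroPairs-image J = cong₂ _∷_ (cong₂ _,_ σ0≡0 σ0≡0) (zero-image J)

collinear-setB : ∀ {a b} → InX a b → Collinear (S'J-pair (a , b) (line a b)) setB
collinear-setB {a} {b} ab =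
  let _ , abc = extend-to-frame ab
      _ , σ-col , σa≡1 , σb≡2 , _ = frame-collineation abc
  in subst (Collinear (S'J-pair (a , b) (line a b))) (image σ-col σa≡1 σb≡2)
       (S'J-pair-image σ-col a b (line a b))
  where
  image : ∀ {σ} → IsCollineation σ → σ a ≡ 1F → σ b ≡ 2F →
    S'J-pair (σ a , σ b) (map σ (line a b)) ≡ setB
  image (_ , σ-hom) σa≡1 σb≡2 rewrite σ-hom a b | σa≡1 | σb≡2 = refl

collinear-setA : ∀ {a b j} → Frame a b j → Collinear (S'J-pair (a , b) (j * b ∷ j * a ∷ j ∷ [])) setA
collinear-setA {a} {b} {j} abj =
  let _ , σ-col , σa≡1 , σb≡2 , σj≡7 = frame-collineation abj
  in subst (Collinear (S'J-pair (a , b) (j * b ∷ j * a ∷ j ∷ []))) (image σ-col σa≡1 σb≡2 σj≡7)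
       (S'J-pair-image σ-col a b (j * b ∷ j * a ∷ j ∷ []))
  where
  image : ∀ {σ} → IsCollineation σ → σ a ≡ 1F → σ b ≡ 2F → σ j ≡ 7F →
    S'J-pair (σ a , σ b) (map σ (j * b ∷ j * a ∷ j ∷ [])) ≡ setA
  image (_ , σ-hom) σa≡1 σb≡2 σj≡7 rewrite σ-hom j b | σ-hom j a | σa≡1 | σb≡2 | σj≡7 = refl

-- Generalised nice sets

module _ {S : PairSet} (S-sym : Symmetric S) (S⊆X : SubsetOfX S) (S-nice : GeneralisedNice S) where

  irreflexive : ∀ {x} → (x , x) ∈ₚ S → ⊥
  irreflexive {x} xx∈S = proj₂ (proj₂ (S⊆X x x xx∈S)) refl

  no-pair-with-product-left : ∀ {a b} → (a , b) ∈ₚ S → (a * b , a) ∈ₚ S → ⊥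
  no-pair-with-product-left {a} {b} ab∈S ab,a∈S =
    let _ , _ , aa∈S , _ = S-nice a b a ab∈S ab,a∈S in irreflexive aa∈S

  no-pair-with-product-right : ∀ {a b} → (a , b) ∈ₚ S → (a * b , b) ∈ₚ S → ⊥
  no-pair-with-product-right {a} {b} ab∈S ab,b∈S =
    let _ , bb∈S , _ = S-nice a b b ab∈S ab,b∈S in irreflexive bb∈S

  one-pair-per-line : ∀ {a b x y} → (a , b) ∈ₚ S → (x , y) ∈ₚ S → x ∈ line a b → y ∈ line a b →
    (x , y) ∈ₚ fromPairs ((a , b) ∷ [])
  one-pair-per-line {a} {b} _ _ (here refl) (there (here refl)) = fromPairs⁺ ((a , b) ∷ []) (inj₁ (here refl))
  one-pair-per-line {a} {b} _ _ (there (here refl)) (here refl) = fromPairs⁺ ((a , b) ∷ []) (inj₂ (here refl))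
  one-pair-per-line {a} ab∈S xy∈S (here refl) (there (there (here refl))) =
    ⊥-elim (no-pair-with-product-left ab∈S (trans (S-sym _ a) xy∈S))
  one-pair-per-line {a} {b} ab∈S xy∈S (there (here refl)) (there (there (here refl))) =
    ⊥-elim (no-pair-with-product-right ab∈S (trans (S-sym _ b) xy∈S))
  one-pair-per-line ab∈S xy∈S (there (there (here refl))) (here refl) =
    ⊥-elim (no-pair-with-product-left ab∈S xy∈S)
  one-pair-per-line ab∈S xy∈S (there (there (here refl))) (there (here refl)) =
    ⊥-elim (no-pair-with-product-right ab∈S xy∈S)
  one-pair-per-line _ xx∈S (here refl)                 (here refl)                 = ⊥-elim (irreflexive xx∈S)
  one-pair-per-line _ xx∈S (there (here refl))         (there (here refl))         = ⊥-elim (irreflexive xx∈S)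
  one-pair-per-line _ xx∈S (there (there (here refl))) (there (there (here refl))) = ⊥-elim (irreflexive xx∈S)

module _ {S : PairSet} (S-sym : Symmetric S) (S⊆X : SubsetOfX S) {j₁ j₂ j₃ : Pt}
         (T-nice : GeneralisedNice (S'J S j₁ j₂ j₃)) where

  private
    J = j₁ ∷ j₂ ∷ j₃ ∷ []
    T = S'J S j₁ j₂ j₃

    S⊆T : ∀ {i j} → (i , j) ∈ₚ S → (i , j) ∈ₚ T
    S⊆T ij∈S = cong (_∨ _) ij∈S

    T-sym : Symmetric T
    T-sym i j = cong₂ _∨_ (S-sym i j) (fromPairs-sym (zeroPairs J) i j)

    zero-pair∈T : ∀ {z} → z ∈ J → (0F , z) ∈ₚ T
    zero-pair∈T {z} z∈J =
      trans (cong (S 0F z ∨_) (fromPairs⁺ (zeroPairs J) {0F} {z} (inj₁ (there (∈-map⁺ (0F ,_) z∈J)))))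
            (∨-zeroʳ (S 0F z))

    zero-pair∈T⁻ : ∀ {z} → (0F , z) ∈ₚ T → z ≢ 0F → z ∈ J
    zero-pair∈T⁻ {z} 0z∈T z≢0 =
      Sum.[ (λ 0z∈S → ⊥-elim (proj₁ (S⊆X 0F z 0z∈S) refl)) , (λ 0z∈Z → zeroPairs-∈ₚ⁻ J 0z∈Z z≢0) ]
        (∨-true 0z∈T)

    J-absorbs : ∀ {a b} → (a , b) ∈ₚ S → a ∈ J → b ∈ J × a * b ∈ J
    J-absorbs {a} {b} ab∈S a∈J =
      let 0*a,b∈T = subst (λ x → (x , b) ∈ₚ T) (sym (*-identityˡ a)) (S⊆T ab∈S)
          _ , _ , b0∈T , 0ab∈T , _ = T-nice 0F a b (zero-pair∈T a∈J) 0*a,b∈T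
          _ , b≢0 , a≢b = S⊆X a b ab∈S
      in zero-pair∈T⁻ (trans (T-sym 0F b) b0∈T) b≢0 , zero-pair∈T⁻ 0ab∈T (a≢b ∘ a*b≡0⇒a≡b)

    J-reflects : ∀ {a b} → (a , b) ∈ₚ S → a * b ∈ J → b ∈ J
    J-reflects {a} {b} ab∈S ab∈J =
      let _ , b0∈T , _ = T-nice a b 0F (S⊆T ab∈S) (trans (T-sym (a * b) 0F) (zero-pair∈T ab∈J))
      in zero-pair∈T⁻ (trans (T-sym 0F b) b0∈T) (proj₁ (proj₂ (S⊆X a b ab∈S)))

  position : ∀ {a b} → (a , b) ∈ₚ S → Position J a b
  position {a} {b} ab∈S with a ∈? J
  ... | yes a∈J =
    let b∈J , ab∈J = J-absorbs ab∈S a∈J in inside (∈-∷⁺ʳ a∈J (∈-∷⁺ʳ b∈J (∈-∷⁺ʳ ab∈J (λ ()))))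
  ... | no a∉J = outside disjoint
    where
    a∈J-from : b ∈ J → a ∈ J
    a∈J-from b∈J = proj₁ (J-absorbs (trans (S-sym b a) ab∈S) b∈J)
    disjoint : Disjoint (line a b) J
    disjoint (here refl , a∈J)                 = a∉J a∈J
    disjoint (there (here refl) , b∈J)         = a∉J (a∈J-from b∈J)
    disjoint (there (there (here refl)) , ab∈J) = a∉J (a∈J-from (J-reflects ab∈S ab∈J))

module Triple {j₁ j₂ j₃ : Pt} (j₁j₂ : InX j₁ j₂) (j₁j₃ : InX j₁ j₃) (j₂j₃ : InX j₂ j₃) where

  J : List Pt
  J = j₁ ∷ j₂ ∷ j₃ ∷ []

  products : List Pt
  products = j₁ * j₂ ∷ j₁ * j₃ ∷ j₂ * j₃ ∷ []

  J-nonzero : ∀ {z} → z ∈ J → z ≢ 0F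
  J-nonzero (here refl)                 = proj₁ j₁j₂
  J-nonzero (there (here refl))         = proj₁ j₂j₃
  J-nonzero (there (there (here refl))) = proj₁ (proj₂ j₂j₃)

  products-distinct : Distinct₃ (j₁ * j₂) (j₁ * j₃) (j₂ * j₃)
  products-distinct =
    proj₂ (proj₂ j₂j₃) ∘ *-cancelˡ-≡ j₁ ,
    proj₂ (proj₂ j₁j₃) ∘ *-cancelˡ-≡ j₂ ∘ trans (*-comm j₂ j₁) ,
    proj₂ (proj₂ j₁j₂) ∘ *-cancelʳ-≡ j₃

  products⊆outside-line : ∀ {a b} → InX a b → Disjoint (line a b) J → products ⊆ line a b
  products⊆outside-line {a} {b} ab ab∩J=∅ =
    ∈-∷⁺ʳ (on j₁j₂ (here refl) (there (here refl))) (∈-∷⁺ʳ (on j₁j₃ (here refl) (there (there (here refl))))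
      (∈-∷⁺ʳ (on j₂j₃ (there (here refl)) (there (there (here refl)))) (λ ())))
    where
    on : ∀ {u v} → InX u v → u ∈ J → v ∈ J → u * v ∈ line a b
    on uv u∈J v∈J = off-line-product∈line ab uv (λ u∈ab → ab∩J=∅ (u∈ab , u∈J)) (λ v∈ab → ab∩J=∅ (v∈ab , v∈J))

  outside-line⊆products : ∀ {a b} → InX a b → Disjoint (line a b) J → line a b ⊆ products
  outside-line⊆products ab ab∩J=∅ = distinct₃-⊆⇒⊇ products-distinct (products⊆outside-line ab ab∩J=∅)

  positioned-line-unique : ∀ {a b x y} → InX a b → InX x y → Position J a b → Position J x y → line x y ⊆ line a b
  positioned-line-unique ab xy (inside ab⊆J) (inside xy⊆J) = distinct₃-⊆⇒⊇ (line-distinct ab) ab⊆J ∘ xy⊆J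
  positioned-line-unique ab xy (inside ab⊆J) (outside xy∩J=∅) =
    let z , z∈ab , z∈xy = lines-meet ab xy in ⊥-elim (xy∩J=∅ (z∈xy , ab⊆J z∈ab))
  positioned-line-unique ab xy (outside ab∩J=∅) (inside xy⊆J) =
    let z , z∈ab , z∈xy = lines-meet ab xy in ⊥-elim (ab∩J=∅ (z∈ab , xy⊆J z∈xy))
  positioned-line-unique ab xy (outside ab∩J=∅) (outside xy∩J=∅) =
    products⊆outside-line ab ab∩J=∅ ∘ outside-line⊆products xy xy∩J=∅

  apex : ∀ {a b} → a ∈ products → b ∈ products → a ≢ b → ∃ λ j → j ∈ J × j * a ∈ J × j * b ∈ J
  apex (here refl)                 (here refl)                 a≢b = ⊥-elim (a≢b refl)
  apex (there (here refl))         (there (here refl))         a≢b = ⊥-elim (a≢b refl)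
  apex (there (there (here refl))) (there (there (here refl))) a≢b = ⊥-elim (a≢b refl)
  apex (here refl)                 (there (here refl))         _ =
    j₁ , here refl , there (here (a*[a*b]≡b j₁ j₂)) , there (there (here (a*[a*b]≡b j₁ j₃)))
  apex (here refl)                 (there (there (here refl))) _ =
    j₂ , there (here refl) , here (b*[a*b]≡a j₁ j₂) , there (there (here (a*[a*b]≡b j₂ j₃)))
  apex (there (here refl))         (here refl)                 _ =
    j₁ , here refl , there (there (here (a*[a*b]≡b j₁ j₃))) , there (here (a*[a*b]≡b j₁ j₂))
  apex (there (here refl))         (there (there (here refl))) _ =
    j₃ , there (there (here refl)) , here (b*[a*b]≡a j₁ j₃) , there (here (b*[a*b]≡a j₂ j₃))
  apex (there (there (here refl))) (here refl)                 _ =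
    j₂ , there (here refl) , there (there (here (a*[a*b]≡b j₂ j₃))) , here (b*[a*b]≡a j₁ j₂)
  apex (there (there (here refl))) (there (here refl))         _ =
    j₃ , there (there (here refl)) , there (here (b*[a*b]≡a j₂ j₃)) , here (b*[a*b]≡a j₁ j₃)

  outside-normal-form : ∀ {a b} → InX a b → Disjoint (line a b) J →
    ∃ λ j → Frame a b j × J ⊆ j * b ∷ j * a ∷ j ∷ [] × j * b ∷ j * a ∷ j ∷ [] ⊆ J
  outside-normal-form {a} {b} ab@(a≢0 , b≢0 , a≢b) ab∩J=∅ =
    let j , j∈J , ja∈J , jb∈J = apex (ab⊆products (here refl)) (ab⊆products (there (here refl))) a≢b
        triple⊆J = ∈-∷⁺ʳ jb∈J (∈-∷⁺ʳ ja∈J (∈-∷⁺ʳ j∈J (λ ())))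
        distinct = a≢b ∘ sym ∘ *-cancelˡ-≡ j , b≢0 ∘ a*b≡a⇒b≡0 , a≢0 ∘ a*b≡a⇒b≡0
    in j , (ab , J-nonzero j∈J , λ j∈ab → ab∩J=∅ (j∈ab , j∈J)) , distinct₃-⊆⇒⊇ distinct triple⊆J , triple⊆J
    where
    ab⊆products : line a b ⊆ products
    ab⊆products = outside-line⊆products ab ab∩J=∅

module Configuration {S : PairSet} (S-sym : Symmetric S) (S⊆X : SubsetOfX S) (S-nice : GeneralisedNice S)
         {j₁ j₂ j₃ : Pt} (j₁j₂ : InX j₁ j₂) (j₁j₃ : InX j₁ j₃) (j₂j₃ : InX j₂ j₃)
         (T-nice : GeneralisedNice (S'J S j₁ j₂ j₃)) where

  open Triple j₁j₂ j₁j₃ j₂j₃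

  S-single-pair : ∀ {a b} → (a , b) ∈ₚ S → S ≈ₚ fromPairs ((a , b) ∷ [])
  S-single-pair {a} {b} ab∈S i j = ⇔→≡ (mk⇔ to from)
    where
    to : (i , j) ∈ₚ S → (i , j) ∈ₚ fromPairs ((a , b) ∷ [])
    to ij∈S = one-pair-per-line S-sym S⊆X S-nice ab∈S ij∈S (ij⊆ab (here refl)) (ij⊆ab (there (here refl)))
      where
      ij⊆ab : line i j ⊆ line a b
      ij⊆ab = positioned-line-unique (S⊆X a b ab∈S) (S⊆X i j ij∈S)
        (position S-sym S⊆X T-nice ab∈S) (position S-sym S⊆X T-nice ij∈S)
    from : (i , j) ∈ₚ fromPairs ((a , b) ∷ []) → (i , j) ∈ₚ S
    from ij∈ab with fromPairs⁻ ((a , b) ∷ []) {i} {j} ij∈ab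
    ... | inj₁ (here refl) = ab∈S
    ... | inj₂ (here refl) = trans (S-sym b a) ab∈S

  S'J-collinear : ∀ {a b} → (a , b) ∈ₚ S → Collinear (S'J S j₁ j₂ j₃) setA ⊎ Collinear (S'J S j₁ j₂ j₃) setB
  S'J-collinear {a} {b} ab∈S = by-position (position S-sym S⊆X T-nice ab∈S)
    where
    ab : InX a b
    ab = S⊆X a b ab∈S
    S'J≈ : S'J S j₁ j₂ j₃ ≈ₚ S'J-pair (a , b) J
    S'J≈ = S'J-single (a , b) j₁ j₂ j₃ (S-single-pair ab∈S)
    by-position : Position J a b → Collinear (S'J S j₁ j₂ j₃) setA ⊎ Collinear (S'J S j₁ j₂ j₃) setB
    by-position (inside ab⊆J) =
      let J⊆ab = distinct₃-⊆⇒⊇ (line-distinct ab) ab⊆J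
      in inj₂ (Collinear-respˡ {U = setB} (≈ₚ-trans S'J≈ (S'J-pair-cong (a , b) J⊆ab ab⊆J)) (collinear-setB ab))
    by-position (outside ab∩J=∅) =
      let _ , abj , J⊆ , ⊆J = outside-normal-form ab ab∩J=∅
      in inj₁ (Collinear-respˡ {U = setA} (≈ₚ-trans S'J≈ (S'J-pair-cong (a , b) J⊆ ⊆J)) (collinear-setA abj))

proposition6p9 : (S : PairSet) → Symmetric S → SubsetOfX S → NonEmpty S → GeneralisedNice S →
    (j₁ j₂ j₃ : Pt) → j₁ ≢ 0F → j₂ ≢ 0F → j₃ ≢ 0F → j₁ ≢ j₂ → j₁ ≢ j₃ → j₂ ≢ j₃ →
    GeneralisedNice (S'J S j₁ j₂ j₃) →
      (card S ≡ 1) × (Collinear (S'J S j₁ j₂ j₃) setA ⊎ Collinear (S'J S j₁ j₂ j₃) setB)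
proposition6p9 S S-sym S⊆X (a , b , ab∈S) S-nice j₁ j₂ j₃ j₁≢0 j₂≢0 j₃≢0 j₁≢j₂ j₁≢j₃ j₂≢j₃ T-nice =
  trans (card-cong (S-single-pair ab∈S)) (card-single-pair (S⊆X a b ab∈S)) , S'J-collinear ab∈S
  where
  open Configuration S-sym S⊆X S-nice (j₁≢0 , j₂≢0 , j₁≢j₂) (j₁≢0 , j₃≢0 , j₁≢j₃) (j₂≢0 , j₃≢0 , j₂≢j₃) T-nice
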